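{- If $a,b$ are integers with $3\leq a\leq b$ and $a\equiv b\pmod 2$, then $n(a,b,4)\leq a+b+2$.
   Context: A weighted graph (wgraph) is a pair $G=(L,H)$ of simple finite graphs with $V(L)=V(H)$ and $E(L)\cap E(H)=\varnothing$; edges of $L$ are light (weight 1) and edges of $H$ are heavy (weight 2). A wcycle is a cycle (of length at least 3) in the graph with edge set $E(L)\cup E(H)$; its weight is the sum of the weights of its edges. The girth of $G$ is the minimum weight of a wcycle. $G$ is $(a,b)$-regular if $L$ is $a$-regular and $H$ is $b$-regular. An $(a,b,g)$-wgraph is an $(a,b)$-regular wgraph of girth $g$; $n(a,b,g)$ is the minimum order of an $(a,b,g)$-wgraph ($\infty$ if none exists). -}

module Defs where

open import Data.Nat using (ℕ; _≤_; _+_)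
open import Data.Bool using (Bool; true; false; _∨_; if_then_else_)
open import Data.Fin using (Fin)
open import Data.List using (List; []; _∷_; [_]; _++_; zip; map; length; allFin)
open import Data.Nat.ListAction using (sum)
open import Data.List.Relation.Unary.All using (All)
open import Data.List.Relation.Unary.Unique.Propositional using (Unique)
open import Data.Product using (_×_; _,_; Σ; ∃)
open import Relation.Binary.PropositionalEquality using (_≡_)

-- A weighted graph on vertex set Fin m: light graph L and heavy graph H,
-- given by Boolean adjacency matrices; both simple (loopless, symmetric),
-- and edge-disjoint.
record WGraph (m : ℕ) : Set where
  field
    L : Fin m → Fin m → Bool
    H : Fin m → Fin m → Bool
    L-irrefl : ∀ i → L i i ≡ false
    H-irrefl : ∀ i → H i i ≡ false
    L-sym : ∀ i j → L i j ≡ L j i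
    H-sym : ∀ i j → H i j ≡ H j i
    disjoint : ∀ i j → L i j ≡ true → H i j ≡ false
open WGraph public

degree : ∀ {m} → (Fin m → Fin m → Bool) → Fin m → ℕ
degree {m} A i = sum (map (λ j → if A i j then 1 else 0) (allFin m))

Regular : ∀ {m} → (Fin m → Fin m → Bool) → ℕ → Set
Regular A d = ∀ i → degree A i ≡ d

ABRegular : ∀ {m} → WGraph m → ℕ → ℕ → Set
ABRegular G a b = Regular (L G) a × Regular (H G) b

adj : ∀ {m} → WGraph m → Fin m → Fin m → Bool
adj G u v = L G u v ∨ H G u v

wt : ∀ {m} → WGraph m → Fin m → Fin m → ℕ
wt G u v = if L G u v then 1 else (if H G u v then 2 else 0)

cyclicPairs : {A : Set} → List A → List (A × A)
cyclicPairs [] = []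
cyclicPairs (x ∷ xs) = zip (x ∷ xs) (xs ++ [ x ])

IsWCycle : ∀ {m} → WGraph m → List (Fin m) → Set
IsWCycle G cs =
  (3 ≤ length cs) × Unique cs
  × All (λ p → adj G (Data.Product.proj₁ p) (Data.Product.proj₂ p) ≡ true) (cyclicPairs cs)

cycleWeight : ∀ {m} → WGraph m → List (Fin m) → ℕ
cycleWeight G cs = sum (map (λ p → wt G (Data.Product.proj₁ p) (Data.Product.proj₂ p)) (cyclicPairs cs))

HasGirth : ∀ {m} → WGraph m → ℕ → Set
HasGirth G g =
  (Σ (List _) λ cs → IsWCycle G cs × cycleWeight G cs ≡ g)
  × (∀ cs → IsWCycle G cs → g ≤ cycleWeight G cs)

IsABGWGraph : ∀ {m} → WGraph m → ℕ → ℕ → ℕ → Set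
IsABGWGraph G a b g = ABRegular G a b × HasGirth G g

-- n(a,b,g) ≤ N  (n is the minimum order of an (a,b,g)-wgraph, ∞ if none):
-- unfolds to the existence of an (a,b,g)-wgraph of order at most N.
nLe : ℕ → ℕ → ℕ → ℕ → Set
nLe a b g N = Σ ℕ λ m → m ≤ N × Σ (WGraph m) λ G → IsABGWGraph G a b g

{-# OPTIONS --safe #-}

-- Write b = a + 2c and k = a + c + 1, and take two copies {0..k-1} and {k..2k-1} of ℤ/k.
-- Joining u to k + j by a light edge when (u + j) mod k < a gives a bipartite a-regular
-- light graph; the pairs with (u + j) mod k = a form a perfect matching, and every other
-- pair of distinct vertices is joined by a heavy edge, so each vertex has
-- 2k - 1 - (a + 1) = b heavy neighbours.  A wcycle with at least four edges weighs at
-- least 4, and a triangle cannot be all light because the light graph is bipartite; the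
-- triangle k, 0, 1 (light, heavy, light) weighs exactly 4.  The order is 2k = a + b + 2.

module Submission where

open import Defs
open import Data.Nat using (ℕ; _≤_; _+_; _%_)
open import Relation.Binary.PropositionalEquality using (_≡_)

open import Data.Bool using (Bool; true; false; not; _∨_; if_then_else_)
open import Data.Bool.Properties using (∨-zeroʳ; ¬-not; not-involutive)
import Data.Fin as Fin
open Fin using (Fin; toℕ; fromℕ<)
open import Data.Fin.Properties using (toℕ-fromℕ<; toℕ<n)
open import Data.List using (List; []; _∷_; [_]; _++_; length; map; tabulate; allFin)
open import Data.List.Properties using (map-tabulate; length-zipWith; length-++-comm)
open import Data.List.Relation.Unary.All as All using (All; []; _∷_)
open import Data.List.Relation.Unary.AllPairs using ([]; _∷_)
open import Data.Nat using (zero; suc; _∸_; _*_; _/_; _<_; _⊓_; z≤n; s≤s; z<s; s<s; NonZero)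
open import Data.Nat.DivMod using (m<n⇒m%n≡m; [m+n]%n≡m%n; m≡m%n+[m/n]*n; /-monoˡ-≤)
open import Data.Nat.ListAction using (sum)
open import Data.Nat.Properties
open import Algebra.Properties.CommutativeSemigroup +-commutativeSemigroup using (interchange)
open import Data.Nat.Tactic.RingSolver using (solve-∀)
open import Data.Product using (_×_; _,_; Σ)
open import Data.Sum using (_⊎_; inj₁; inj₂)
open import Function using (_∘_; id)
open import Relation.Binary.PropositionalEquality
  using (refl; sym; trans; cong; cong₂; subst; _≢_; ≢-sym; subst₂; module ≡-Reasoning)
open import Relation.Nullary using (¬_; Dec; contradiction; yes; no)
open import Relation.Nullary.Decidable using (does; dec-true; dec-false)

open ≡-Reasoning

∑< : ℕ → (ℕ → ℕ) → ℕ
∑< zero    f = 0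
∑< (suc n) f = f 0 + ∑< n (f ∘ suc)

∑<-cong : ∀ n {f g : ℕ → ℕ} → (∀ j → j < n → f j ≡ g j) → ∑< n f ≡ ∑< n g
∑<-cong zero    _   = refl
∑<-cong (suc n) f≗g = cong₂ _+_ (f≗g 0 z<s) (∑<-cong n (λ j j<n → f≗g (suc j) (s<s j<n)))

∑<-const : ∀ n x → ∑< n (λ _ → x) ≡ n * x
∑<-const zero    x = refl
∑<-const (suc n) x = cong (x +_) (∑<-const n x)

∑<-zero : ∀ n → ∑< n (λ _ → 0) ≡ 0
∑<-zero n = trans (∑<-const n 0) (*-zeroʳ n)

∑<-+ : ∀ m n f → ∑< (m + n) f ≡ ∑< m f + ∑< n (λ j → f (m + j))
∑<-+ zero    n f = refl
∑<-+ (suc m) n f = trans (cong (f 0 +_) (∑<-+ m n (f ∘ suc))) (sym (+-assoc (f 0) _ _))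

∑<-distrib : ∀ n f g → ∑< n (λ j → f j + g j) ≡ ∑< n f + ∑< n g
∑<-distrib zero    f g = refl
∑<-distrib (suc n) f g =
  trans (cong (f 0 + g 0 +_) (∑<-distrib n (f ∘ suc) (g ∘ suc))) (interchange (f 0) (g 0) _ _)

∑<-last : ∀ n f → ∑< (suc n) f ≡ ∑< n f + f n
∑<-last zero    f = +-comm (f 0) 0
∑<-last (suc n) f = trans (cong (f 0 +_) (∑<-last n (f ∘ suc))) (sym (+-assoc (f 0) _ _))

∑<-cycle : ∀ n g → g n ≡ g 0 → ∑< n (g ∘ suc) ≡ ∑< n g
∑<-cycle n g gn≡g0 = +-cancelˡ-≡ (g 0) _ _ (begin
  ∑< (suc n) g      ≡⟨ ∑<-last n g ⟩
  ∑< n g + g n      ≡⟨ cong (∑< n g +_) gn≡g0 ⟩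
  ∑< n g + g 0      ≡⟨ +-comm (∑< n g) (g 0) ⟩
  g 0 + ∑< n g      ∎)

∑<-rotate : ∀ k .{{_ : NonZero k}} s h → ∑< k (λ j → h ((j + s) % k)) ≡ ∑< k h
∑<-rotate k zero h =
  ∑<-cong k (λ j j<k → cong h (trans (cong (_% k) (+-identityʳ j)) (m<n⇒m%n≡m j<k)))
∑<-rotate k (suc s) h = begin
  ∑< k (λ j → h ((j + suc s) % k)) ≡⟨ ∑<-cong k (λ j _ → cong (λ t → h (t % k)) (+-suc j s)) ⟩
  ∑< k (g ∘ suc)                   ≡⟨ ∑<-cycle k g gk≡g0 ⟩
  ∑< k g                           ≡⟨ ∑<-rotate k s h ⟩
  ∑< k h                           ∎
  where
  g : ℕ → ℕ
  g t = h ((t + s) % k)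
  gk≡g0 : g k ≡ g 0
  gk≡g0 = cong h (trans (cong (_% k) (+-comm k s)) ([m+n]%n≡m%n s k))

𝟙 : Bool → ℕ
𝟙 b = if b then 1 else 0

count< : ℕ → (ℕ → Bool) → ℕ
count< n p = ∑< n (𝟙 ∘ p)

count<-<? : ∀ {a n} → a ≤ n → count< n (λ t → does (t <? a)) ≡ a
count<-<? {zero}  {n}     _         = ∑<-zero n
count<-<? {suc a} {suc n} (s≤s a≤n) = cong suc (count<-<? a≤n)

count<-≟ : ∀ {u n} → u < n → count< n (λ v → does (u ≟ v)) ≡ 1
count<-≟ {zero}  {suc n} _         = cong suc (∑<-zero n)
count<-≟ {suc u} {suc n} (s<s u<n) = count<-≟ u<n

sum-tabulate-toℕ : ∀ m (h : ℕ → ℕ) → sum (tabulate {n = m} (h ∘ toℕ)) ≡ ∑< m h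
sum-tabulate-toℕ zero    h = refl
sum-tabulate-toℕ (suc m) h = cong (h 0 +_) (sum-tabulate-toℕ m (h ∘ suc))

degree-toℕ : ∀ m (X : ℕ → ℕ → Bool) (i : Fin m) →
             degree (λ u v → X (toℕ u) (toℕ v)) i ≡ count< m (X (toℕ i))
degree-toℕ m X i = begin
  sum (map (𝟙 ∘ X (toℕ i) ∘ toℕ) (allFin m))  ≡⟨ cong sum (map-tabulate {n = m} id (𝟙 ∘ X (toℕ i) ∘ toℕ)) ⟩
  sum (tabulate {n = m} (𝟙 ∘ X (toℕ i) ∘ toℕ)) ≡⟨ sum-tabulate-toℕ m (𝟙 ∘ X (toℕ i)) ⟩
  count< m (X (toℕ i))                         ∎

does-true⁻¹ : ∀ {p} {P : Set p} (P? : Dec P) → does P? ≡ true → P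
does-true⁻¹ (yes p) _  = p
does-true⁻¹ (no _)  ()

complement : (ℕ → ℕ → Bool) → ℕ → ℕ → Bool
complement X u v = not (does (u ≟ v) ∨ X u v)

complement-irrefl : ∀ X u → complement X u u ≡ false
complement-irrefl X u = cong (λ e → not (e ∨ X u u)) (dec-true (u ≟ u) refl)

does-≟-sym : ∀ u v → does (u ≟ v) ≡ does (v ≟ u)
does-≟-sym u v with u ≟ v
... | yes refl = refl
... | no  u≢v  = trans (dec-false (u ≟ v) u≢v) (sym (dec-false (v ≟ u) (u≢v ∘ sym)))

complement-sym : ∀ {X} → (∀ u v → X u v ≡ X v u) → ∀ u v → complement X u v ≡ complement X v u
complement-sym X-sym u v = cong₂ (λ e x → not (e ∨ x)) (does-≟-sym u v) (X-sym u v)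

complement-disjoint : ∀ X u v → X u v ≡ true → complement X u v ≡ false
complement-disjoint X u v Xuv = cong not (trans (cong (does (u ≟ v) ∨_) Xuv) (∨-zeroʳ _))

count<-complement : ∀ n X u → X u u ≡ false → u < n →
                    count< n (complement X u) + suc (count< n (X u)) ≡ n
count<-complement n X u Xuu u<n = begin
  count< n (complement X u) + suc (count< n (X u))
    ≡⟨ cong (λ e → count< n (complement X u) + (e + count< n (X u))) (count<-≟ u<n) ⟨
  count< n (complement X u) + (count< n (λ v → does (u ≟ v)) + count< n (X u))
    ≡⟨ cong (count< n (complement X u) +_) (∑<-distrib n (𝟙 ∘ (λ v → does (u ≟ v))) (𝟙 ∘ X u)) ⟨
  count< n (complement X u) + ∑< n (λ v → 𝟙 (does (u ≟ v)) + 𝟙 (X u v))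
    ≡⟨ ∑<-distrib n (𝟙 ∘ complement X u) _ ⟨
  ∑< n (λ v → 𝟙 (complement X u v) + (𝟙 (does (u ≟ v)) + 𝟙 (X u v)))
    ≡⟨ ∑<-cong n (λ v _ → 𝟙-partition (does (u ≟ v)) (X u v) (loopless v)) ⟩
  ∑< n (λ _ → 1)
    ≡⟨ trans (∑<-const n 1) (*-identityʳ n) ⟩
  n ∎
  where
  𝟙-partition : ∀ e x → (e ≡ true → x ≡ false) → 𝟙 (not (e ∨ x)) + (𝟙 e + 𝟙 x) ≡ 1
  𝟙-partition true  true  e⇒¬x = contradiction (e⇒¬x refl) λ ()
  𝟙-partition true  false _    = refl
  𝟙-partition false true  _    = refl
  𝟙-partition false false _    = refl
  loopless : ∀ v → does (u ≟ v) ≡ true → X u v ≡ false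
  loopless v u≟v = subst (λ w → X u w ≡ false) (does-true⁻¹ (u ≟ v) u≟v) Xuu

across : (ℕ → ℕ → Bool) → Bool → Bool → ℕ → ℕ → Bool
across R true  false u v = R u v
across R false true  u v = R v u
across R _     _     u v = false

across-sameSide : ∀ R s u v → across R s s u v ≡ false
across-sameSide R true  u v = refl
across-sameSide R false u v = refl

across-sym : ∀ R s t u v → across R s t u v ≡ across R t s v u
across-sym R true  true  u v = refl
across-sym R true  false u v = refl
across-sym R false true  u v = refl
across-sym R false false u v = refl

across⇒≢ : ∀ R s t u v → across R s t u v ≡ true → s ≢ t
across⇒≢ R true  true  u v ()
across⇒≢ R true  false u v _ ()
across⇒≢ R false true  u v _ ()
across⇒≢ R false false u v ()

across-mono : ∀ {R R′} → (∀ u v → R u v ≡ true → R′ u v ≡ true) →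
              ∀ s t u v → across R s t u v ≡ true → across R′ s t u v ≡ true
across-mono R⇒R′ true  false u v = R⇒R′ u v
across-mono R⇒R′ false true  u v = R⇒R′ v u
across-mono R⇒R′ true  true  u v ()
across-mono R⇒R′ false false u v ()

length-cyclicPairs : ∀ {A : Set} (xs : List A) → length (cyclicPairs xs) ≡ length xs
length-cyclicPairs []       = refl
length-cyclicPairs (x ∷ xs) = begin
  length (cyclicPairs (x ∷ xs))           ≡⟨ length-zipWith _,_ (x ∷ xs) (xs ++ [ x ]) ⟩
  suc (length xs) ⊓ length (xs ++ [ x ]) ≡⟨ cong (suc (length xs) ⊓_) (length-++-comm xs [ x ]) ⟩
  suc (length xs) ⊓ suc (length xs)      ≡⟨ ⊓-idem (suc (length xs)) ⟩
  suc (length xs)                        ∎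

length≤sum : ∀ {A : Set} (f : A → ℕ) {xs} → All (λ x → 1 ≤ f x) xs → length xs ≤ sum (map f xs)
length≤sum f []         = z≤n
length≤sum f (1≤fx ∷ p) = +-mono-≤ 1≤fx (length≤sum f p)

+-mono-≤₃ : ∀ {m₁ m₂ m₃ n₁ n₂ n₃} → m₁ ≤ n₁ → m₂ ≤ n₂ → m₃ ≤ n₃ →
            m₁ + (m₂ + (m₃ + 0)) ≤ n₁ + (n₂ + (n₃ + 0))
+-mono-≤₃ p₁ p₂ p₃ = +-mono-≤ p₁ (+-mono-≤ p₂ (+-mono-≤ p₃ ≤-refl))

module _ {m} (G : WGraph m) where

  light⇒≢ : ∀ {u v} → L G u v ≡ true → u ≢ v
  light⇒≢ {u} Luv refl = contradiction (trans (sym Luv) (L-irrefl G u)) λ ()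

  heavy⇒≢ : ∀ {u v} → H G u v ≡ true → u ≢ v
  heavy⇒≢ {u} Huv refl = contradiction (trans (sym Huv) (H-irrefl G u)) λ ()

  light⇒adj : ∀ {u v} → L G u v ≡ true → adj G u v ≡ true
  light⇒adj {u} {v} Luv = cong (_∨ H G u v) Luv

  heavy⇒adj : ∀ {u v} → H G u v ≡ true → adj G u v ≡ true
  heavy⇒adj {u} {v} Huv = trans (cong (L G u v ∨_) Huv) (∨-zeroʳ _)

  wt-light : ∀ {u v} → L G u v ≡ true → wt G u v ≡ 1
  wt-light Luv rewrite Luv = refl

  wt-heavy : ∀ {u v} → H G u v ≡ true → wt G u v ≡ 2
  wt-heavy {u} {v} Huv with L G u v in Luv
  ... | true  = contradiction (trans (sym Huv) (disjoint G u v Luv)) λ ()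
  ... | false rewrite Huv = refl

  heavy⇒2≤wt : ∀ {u v} → H G u v ≡ true → 2 ≤ wt G u v
  heavy⇒2≤wt Huv = ≤-reflexive (sym (wt-heavy Huv))

  adj⇒light⊎heavy : ∀ u v → adj G u v ≡ true → L G u v ≡ true ⊎ H G u v ≡ true
  adj⇒light⊎heavy u v with L G u v | H G u v
  ... | true  | _    = λ _ → inj₁ refl
  ... | false | true = λ _ → inj₂ refl
  ... | false | false = λ ()

  1≤wt : ∀ u v → adj G u v ≡ true → 1 ≤ wt G u v
  1≤wt u v Auv with adj⇒light⊎heavy u v Auv
  ... | inj₁ Luv = ≤-reflexive (sym (wt-light Luv))
  ... | inj₂ Huv = ≤-trans (s≤s z≤n) (heavy⇒2≤wt Huv)

  length≤cycleWeight : ∀ {cs} → IsWCycle G cs → length cs ≤ cycleWeight G cs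
  length≤cycleWeight {cs} (_ , _ , adjacent) =
    subst (_≤ cycleWeight G cs) (length-cyclicPairs cs)
          (length≤sum _ (All.map (λ {(u , v)} → 1≤wt u v) adjacent))

  light-heavy-light-wcycle : ∀ {x y z} → L G x y ≡ true → H G y z ≡ true → L G z x ≡ true →
                             IsWCycle G (x ∷ y ∷ z ∷ []) × cycleWeight G (x ∷ y ∷ z ∷ []) ≡ 4
  light-heavy-light-wcycle Lxy Hyz Lzx =
    ( s≤s (s≤s (s≤s z≤n))
    , (light⇒≢ Lxy ∷ ≢-sym (light⇒≢ Lzx) ∷ []) ∷ (heavy⇒≢ Hyz ∷ []) ∷ [] ∷ []
    , light⇒adj Lxy ∷ heavy⇒adj Hyz ∷ light⇒adj Lzx ∷ [] )
    , cong₂ _+_ (wt-light Lxy) (cong₂ _+_ (wt-heavy Hyz) (cong (_+ 0) (wt-light Lzx)))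

  module _ (side : Fin m → Bool) (light-crosses : ∀ u v → L G u v ≡ true → side u ≢ side v) where

    no-light-triangle : ∀ {x y z} → L G x y ≡ true → L G y z ≡ true → ¬ L G z x ≡ true
    no-light-triangle {x} {y} {z} Lxy Lyz Lzx = light-crosses z x Lzx (begin
      side z             ≡⟨ ¬-not (≢-sym (light-crosses y z Lyz)) ⟩
      not (side y)       ≡⟨ cong not (¬-not (≢-sym (light-crosses x y Lxy))) ⟩
      not (not (side x)) ≡⟨ not-involutive (side x) ⟩
      side x             ∎)

    4≤triangleWeight : ∀ {x y z} → IsWCycle G (x ∷ y ∷ z ∷ []) →
                       4 ≤ cycleWeight G (x ∷ y ∷ z ∷ [])
    4≤triangleWeight {x} {y} {z} (_ , _ , xy ∷ yz ∷ zx ∷ [])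
      with adj⇒light⊎heavy x y xy | adj⇒light⊎heavy y z yz | adj⇒light⊎heavy z x zx
    ... | inj₂ Hxy | _        | _        = +-mono-≤₃ (heavy⇒2≤wt Hxy) (1≤wt y z yz) (1≤wt z x zx)
    ... | inj₁ _   | inj₂ Hyz | _        = +-mono-≤₃ (1≤wt x y xy) (heavy⇒2≤wt Hyz) (1≤wt z x zx)
    ... | inj₁ _   | inj₁ _   | inj₂ Hzx = +-mono-≤₃ (1≤wt x y xy) (1≤wt y z yz) (heavy⇒2≤wt Hzx)
    ... | inj₁ Lxy | inj₁ Lyz | inj₁ Lzx = contradiction Lzx (no-light-triangle Lxy Lyz)

    4≤cycleWeight : ∀ cs → IsWCycle G cs → 4 ≤ cycleWeight G cs
    4≤cycleWeight []                    (() , _)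
    4≤cycleWeight (_ ∷ [])              (s≤s () , _)
    4≤cycleWeight (_ ∷ _ ∷ [])          (s≤s (s≤s ()) , _)
    4≤cycleWeight (_ ∷ _ ∷ _ ∷ [])      cycle = 4≤triangleWeight cycle
    4≤cycleWeight (_ ∷ _ ∷ _ ∷ _ ∷ _)  cycle =
      ≤-trans (s≤s (s≤s (s≤s (s≤s z≤n)))) (length≤cycleWeight cycle)

    girth≡4 : ∀ {x y z} → L G x y ≡ true → H G y z ≡ true → L G z x ≡ true → HasGirth G 4
    girth≡4 Lxy Hyz Lzx = (_ , light-heavy-light-wcycle Lxy Hyz Lzx) , 4≤cycleWeight

module Circulant (k : ℕ) .{{_ : NonZero k}} where

  count<-across : ∀ R s u → count< (k + k) (λ v → across R s (does (v <? k)) u v)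
                  ≡ count< k (λ j → across R s true u j) + count< k (λ j → across R s false u (k + j))
  count<-across R s u = trans (∑<-+ k k _) (cong₂ _+_
    (∑<-cong k λ j j<k → cong (λ t → 𝟙 (across R s t u j)) (dec-true (j <? k) j<k))
    (∑<-cong k λ j _   → cong (λ t → 𝟙 (across R s t u (k + j)))
                              (dec-false (k + j <? k) (≤⇒≯ (m≤m+n k j)))))

  circulantLink : (ℕ → Bool) → ℕ → ℕ → Bool
  circulantLink P i j = P ((i + (j ∸ k)) % k)

  -- u < k and k + j (j < k) are adjacent iff P ((u + j) mod k)
  circulant : (ℕ → Bool) → ℕ → ℕ → Bool
  circulant P u v = across (circulantLink P) (does (u <? k)) (does (v <? k)) u v

  circulant-irrefl : ∀ P u → circulant P u u ≡ false
  circulant-irrefl P u = across-sameSide (circulantLink P) (does (u <? k)) u u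

  circulant-sym : ∀ P u v → circulant P u v ≡ circulant P v u
  circulant-sym P u v = across-sym (circulantLink P) (does (u <? k)) (does (v <? k)) u v

  circulant-crosses : ∀ P u v → circulant P u v ≡ true → does (u <? k) ≢ does (v <? k)
  circulant-crosses P u v = across⇒≢ (circulantLink P) (does (u <? k)) (does (v <? k)) u v

  circulant-mono : ∀ {P Q} → (∀ t → P t ≡ true → Q t ≡ true) →
                   ∀ u v → circulant P u v ≡ true → circulant Q u v ≡ true
  circulant-mono P⇒Q u v =
    across-mono (λ i j → P⇒Q ((i + (j ∸ k)) % k)) (does (u <? k)) (does (v <? k)) u v

  count<-circulant : ∀ P u → count< (k + k) (circulant P u) ≡ count< k P
  count<-circulant P u = count<-side (does (u <? k))
    where
    R : ℕ → ℕ → Bool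
    R = circulantLink P

    count<-side : ∀ s → count< (k + k) (λ v → across R s (does (v <? k)) u v) ≡ count< k P
    count<-side true = begin
      count< (k + k) (λ v → across R true (does (v <? k)) u v) ≡⟨ count<-across R true u ⟩
      ∑< k (λ _ → 0) + count< k (λ j → R u (k + j))           ≡⟨ cong₂ _+_ (∑<-zero k) (∑<-cong k λ j _ →
                                                                  cong (𝟙 ∘ P ∘ (_% k)) (u+[k+j∸k]≡j+u j)) ⟩
      count< k (λ j → P ((j + u) % k))                         ≡⟨ ∑<-rotate k u (𝟙 ∘ P) ⟩
      count< k P                                               ∎
      where
      u+[k+j∸k]≡j+u : ∀ j → u + (k + j ∸ k) ≡ j + u
      u+[k+j∸k]≡j+u j = trans (cong (u +_) (m+n∸m≡n k j)) (+-comm u j)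
    count<-side false = begin
      count< (k + k) (λ v → across R false (does (v <? k)) u v) ≡⟨ count<-across R false u ⟩
      count< k (λ j → R j u) + ∑< k (λ _ → 0)                  ≡⟨ cong (count< k (λ j → R j u) +_) (∑<-zero k) ⟩
      count< k (λ j → R j u) + 0                               ≡⟨ +-identityʳ _ ⟩
      count< k (λ j → P ((j + (u ∸ k)) % k))                   ≡⟨ ∑<-rotate k (u ∸ k) (𝟙 ∘ P) ⟩
      count< k P                                               ∎

module CirculantWGraph (a c : ℕ) (2≤a : 2 ≤ a) where

  k : ℕ
  k = suc (a + c)

  N : ℕ
  N = k + k

  open Circulant k

  lightOffset notHeavyOffset : ℕ → Bool
  lightOffset    t = does (t <? a)
  notHeavyOffset t = does (t <? suc a)

  light notHeavy heavy : ℕ → ℕ → Bool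
  light    = circulant lightOffset
  notHeavy = circulant notHeavyOffset
  heavy    = complement notHeavy

  light⇒notHeavy : ∀ u v → light u v ≡ true → notHeavy u v ≡ true
  light⇒notHeavy = circulant-mono λ t t<a →
    dec-true (t <? suc a) (m<n⇒m<1+n (does-true⁻¹ (t <? a) t<a))

  a<k : a < k
  a<k = s≤s (m≤m+n a c)

  light-degree : ∀ u → count< N (light u) ≡ a
  light-degree u = trans (count<-circulant lightOffset u) (count<-<? (<⇒≤ a<k))

  notHeavy-degree : ∀ u → count< N (notHeavy u) ≡ suc a
  notHeavy-degree u = trans (count<-circulant notHeavyOffset u) (count<-<? a<k)

  heavy-degree : ∀ u → u < N → count< N (heavy u) ≡ a + (c + c)
  heavy-degree u u<N = +-cancelʳ-≡ (suc (suc a)) _ _ (begin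
    count< N (heavy u) + suc (suc a)
      ≡⟨ cong (λ d → count< N (heavy u) + suc d) (notHeavy-degree u) ⟨
    count< N (heavy u) + suc (count< N (notHeavy u))
      ≡⟨ count<-complement N notHeavy u (circulant-irrefl notHeavyOffset u) u<N ⟩
    N
      ≡⟨ N≡b+a+2 a c ⟩
    a + (c + c) + suc (suc a) ∎)
    where
    N≡b+a+2 : ∀ a c → suc (a + c) + suc (a + c) ≡ a + (c + c) + suc (suc a)
    N≡b+a+2 = solve-∀

  G : WGraph N
  G = record
    { L        = λ u v → light (toℕ u) (toℕ v)
    ; H        = λ u v → heavy (toℕ u) (toℕ v)
    ; L-irrefl = λ u → circulant-irrefl lightOffset (toℕ u)
    ; H-irrefl = λ u → complement-irrefl notHeavy (toℕ u)
    ; L-sym    = λ u v → circulant-sym lightOffset (toℕ u) (toℕ v)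
    ; H-sym    = λ u v → complement-sym (circulant-sym notHeavyOffset) (toℕ u) (toℕ v)
    ; disjoint = λ u v Luv →
        complement-disjoint notHeavy (toℕ u) (toℕ v) (light⇒notHeavy (toℕ u) (toℕ v) Luv)
    }

  regular : ABRegular G a (a + (c + c))
  regular = (λ u → trans (degree-toℕ N light u) (light-degree (toℕ u)))
          , (λ u → trans (degree-toℕ N heavy u) (heavy-degree (toℕ u) (toℕ<n u)))

  1<k : 1 < k
  1<k = s≤s (≤-trans (s≤s z≤n) (≤-trans 2≤a (m≤m+n a c)))

  k≮k : does (k <? k) ≡ false
  k≮k = dec-false (k <? k) (n≮n k)

  light-k-0 : light k 0 ≡ true
  light-k-0 = begin
    light k 0                       ≡⟨ cong (λ s → across (circulantLink lightOffset) s true k 0) k≮k ⟩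
    lightOffset ((0 + (k ∸ k)) % k) ≡⟨ cong (λ t → lightOffset ((0 + t) % k)) (n∸n≡0 k) ⟩
    lightOffset 0                   ≡⟨ dec-true (0 <? a) (≤-trans (s≤s z≤n) 2≤a) ⟩
    true                            ∎

  light-1-k : light 1 k ≡ true
  light-1-k = begin
    light 1 k                       ≡⟨ cong₂ (λ s t → across (circulantLink lightOffset) s t 1 k)
                                             (dec-true (1 <? k) 1<k) k≮k ⟩
    lightOffset ((1 + (k ∸ k)) % k) ≡⟨ cong (λ t → lightOffset ((1 + t) % k)) (n∸n≡0 k) ⟩
    lightOffset (1 % k)             ≡⟨ cong lightOffset (m<n⇒m%n≡m 1<k) ⟩
    lightOffset 1                   ≡⟨ dec-true (1 <? a) 2≤a ⟩
    true                            ∎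

  heavy-0-1 : heavy 0 1 ≡ true
  heavy-0-1 =
    cong (λ s → not (across (circulantLink notHeavyOffset) true s 0 1)) (dec-true (1 <? k) 1<k)

  girth : HasGirth G 4
  girth =
    girth≡4 G (λ u → does (toℕ u <? k)) (λ u v → circulant-crosses lightOffset (toℕ u) (toℕ v))
    {x = fromℕ< k<N} {y = Fin.zero} {z = fromℕ< 1<N}
    (subst (λ u → light u 0 ≡ true) (sym (toℕ-fromℕ< k<N)) light-k-0)
    (subst (λ v → heavy 0 v ≡ true) (sym (toℕ-fromℕ< 1<N)) heavy-0-1)
    (subst₂ (λ u v → light u v ≡ true) (sym (toℕ-fromℕ< 1<N)) (sym (toℕ-fromℕ< k<N)) light-1-k)
    where
    k<N : k < N
    k<N = m<m+n k z<s
    1<N : 1 < N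
    1<N = ≤-trans 1<k (m≤m+n k k)

even-difference : ∀ {a b} → a ≤ b → a % 2 ≡ b % 2 → Σ ℕ λ c → b ≡ a + (c + c)
even-difference {a} {b} a≤b a≡b = c , (begin
  b                           ≡⟨ m≡m%n+[m/n]*n b 2 ⟩
  b % 2 + b / 2 * 2           ≡⟨ cong₂ (λ r q → r + q * 2) (sym a≡b) (sym (m+[n∸m]≡n (/-monoˡ-≤ 2 a≤b))) ⟩
  a % 2 + (a / 2 + c) * 2     ≡⟨ regroup (a % 2) (a / 2) c ⟩
  a % 2 + a / 2 * 2 + (c + c) ≡⟨ cong (_+ (c + c)) (m≡m%n+[m/n]*n a 2) ⟨
  a + (c + c)                 ∎)
  where
  c : ℕ
  c = b / 2 ∸ a / 2
  regroup : ∀ r q c → r + (q + c) * 2 ≡ r + q * 2 + (c + c)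
  regroup = solve-∀

lemma12 : (a b : ℕ) → 3 ≤ a → a ≤ b → a % 2 ≡ b % 2
    → nLe a b 4 (a + b + 2)
lemma12 a b 3≤a a≤b a≡b with even-difference a≤b a≡b
... | c , refl = N , ≤-reflexive (order a c) , G , regular , girth
  where
  open CirculantWGraph a c (≤-trans (n≤1+n 2) 3≤a)
  order : ∀ a c → suc (a + c) + suc (a + c) ≡ a + (a + (c + c)) + 2
  order = solve-∀
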